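{- Let $l$ and $n$ be positive integers and suppose that $C_l(n)=\frac{1}{(n+1)^l}\cdot\frac{((l+1)n)!}{(n!)^{l+1}}$ is not an integer. Then $n+1$ is a prime power, and $l+1$ has at least two non-zero digits in its base-$(n+1)$ expansion. -}

module Defs where

open import Data.Nat using (ℕ; suc; _^_; _≤_; _+_)
open import Data.Nat.Primality using (Prime)
open import Data.Product using (Σ; _×_)
open import Data.Fin using (Fin; toℕ)
open import Data.List using (List; length; filter)
open import Data.Digit using (Expansion; fromDigits)
open import Relation.Binary.PropositionalEquality using (_≡_)
open import Relation.Nullary using (¬_; ¬?)
open import Relation.Unary using (Decidable)
open import Data.Nat using (_≟_)


IsPrimePower : ℕ → Set
IsPrimePower m = Σ ℕ λ p → Σ ℕ λ k → Prime p × (1 ≤ k) × (m ≡ p ^ k)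

nonZeroDigits : ∀ {b} → Expansion b → ℕ
nonZeroDigits {b} ds = length (filter (λ d → ¬? (toℕ d ≟ 0)) ds)

-- m has at least two non-zero digits in its base-b expansion.
-- Quantified over every digit list representing m (all such lists differ
-- only by trailing zeros, so this is the usual notion).
AtLeastTwoNonZeroDigits : (b m : ℕ) → Set
AtLeastTwoNonZeroDigits b m = (ds : Expansion b) → fromDigits ds ≡ m → 2 ≤ nonZeroDigits ds

-- Work one prime q at a time. With q ^ a ∥ n + 1 and Legendre's formula ν_q(N!) = Σ_{i ≥ 1} ⌊N / q^i⌋,
-- the denominator of C_l(n) has valuation l a + (l + 1) ν_q(n!), so C_l(n) is an integer once
-- (l + 1) ν_q((n + 1)!) ≤ ν_q(((l + 1) n)!) + a for every q. Pairing the terms i and K + i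
-- (1 ≤ i ≤ a ≤ K, n < q^(K+1)) of the sum for ((l + 1) n)! gains at least l over (l + 1) times the sum
-- for n! at each pair. This settles q^a ≤ n (choose q^K ≤ n < q^(K+1)), and n + 1 = q^a with
-- l + 1 ≤ n + 1 (choose K = a). Multiplying l + 1 by n + 1 = q^a raises both sides by the same amount,
-- so the bound persists for l + 1 = d (n + 1)^k with a single digit d.

module Submission where

open import Data.Digit using (Expansion; fromDigits)
open import Data.Empty using (⊥-elim)
open import Data.Fin using (toℕ)
open import Data.Fin.Properties using (toℕ<n)
open import Data.List using ([]; _∷_)
open import Data.List.Relation.Unary.All using (_∷_)
open import Data.Nat
open import Data.Nat.Coprimality using (Coprime; coprime-divisor) renaming (sym to ⊥-sym)
open import Data.Nat.Divisibility
open import Data.Nat.DivMod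
open import Data.Nat.Induction using (<-rec)
open import Data.Nat.ListAction using (product)
open import Data.Nat.Primality
open import Data.Nat.Primality.Factorisation using (factorise)
open import Data.Nat.Properties
open import Algebra.Properties.CommutativeSemigroup +-commutativeSemigroup
  using ()
  renaming (interchange to +-interchange; x∙yz≈y∙xz to x+[y+z]≡y+[x+z]; xy∙z≈xz∙y to x+y+z≡x+z+y)
open import Algebra.Properties.CommutativeSemigroup *-commutativeSemigroup
  using () renaming (interchange to *-interchange; x∙yz≈y∙xz to x*[y*z]≡y*[x*z])
open import Data.Nat.Tactic.RingSolver using (solve-∀)
open import Data.Product using (∃-syntax; _×_; _,_)
open import Data.Sum using (_⊎_; inj₁; inj₂)
open import Function using (_∘_)
open import Relation.Binary.PropositionalEquality
open import Relation.Nullary using (¬_; Dec; yes; no; contradiction)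

open import Defs

-- ∑ B f = f 1 + ⋯ + f B: indices start at 1, as in Legendre's formula.
∑ : ℕ → (ℕ → ℕ) → ℕ
∑ zero    f = 0
∑ (suc B) f = f 1 + ∑ B (f ∘ suc)

∑-cong : ∀ B {f g : ℕ → ℕ} → (∀ i → f i ≡ g i) → ∑ B f ≡ ∑ B g
∑-cong zero    f≗g = refl
∑-cong (suc B) f≗g = cong₂ _+_ (f≗g 1) (∑-cong B (f≗g ∘ suc))

∑-distrib-+ : ∀ B f g → ∑ B (λ i → f i + g i) ≡ ∑ B f + ∑ B g
∑-distrib-+ zero    f g = refl
∑-distrib-+ (suc B) f g =
  trans (cong (f 1 + g 1 +_) (∑-distrib-+ B (f ∘ suc) (g ∘ suc))) (+-interchange (f 1) (g 1) _ _)

∑-distribˡ-* : ∀ B c f → ∑ B (λ i → c * f i) ≡ c * ∑ B f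
∑-distribˡ-* zero    c f = sym (*-zeroʳ c)
∑-distribˡ-* (suc B) c f =
  trans (cong (c * f 1 +_) (∑-distribˡ-* B c (f ∘ suc))) (sym (*-distribˡ-+ c (f 1) _))

∑-split : ∀ K a f → ∑ (K + a) f ≡ ∑ K f + ∑ a (λ i → f (K + i))
∑-split zero    a f = refl
∑-split (suc K) a f = trans (cong (f 1 +_) (∑-split K a (f ∘ suc))) (sym (+-assoc (f 1) _ _))

∑-monoˡ-≤ : ∀ {K B} f → K ≤ B → ∑ K f ≤ ∑ B f
∑-monoˡ-≤ {K} {B} f K≤B = begin
  ∑ K f                                ≤⟨ m≤m+n _ _ ⟩
  ∑ K f + ∑ (B ∸ K) (λ i → f (K + i)) ≡⟨ ∑-split K (B ∸ K) f ⟨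
  ∑ (K + (B ∸ K)) f                    ≡⟨ cong (λ C → ∑ C f) (m+[n∸m]≡n K≤B) ⟩
  ∑ B f                                ∎
  where open ≤-Reasoning

∑-vanishing : ∀ N B f → N ≤ B → (∀ i → N < i → f i ≡ 0) → ∑ B f ≡ ∑ N f
∑-vanishing zero    zero    f _         _ = refl
∑-vanishing zero    (suc B) f _         f≡0 =
  cong₂ _+_ (f≡0 1 z<s) (∑-vanishing zero B (f ∘ suc) z≤n (λ i _ → f≡0 (suc i) z<s))
∑-vanishing (suc N) (suc B) f (s≤s N≤B) f≡0 =
  cong (f 1 +_) (∑-vanishing N B (f ∘ suc) N≤B (λ i N<i → f≡0 (suc i) (s<s N<i)))

∑-lowerBound : ∀ a c f → (∀ i → 1 ≤ i → i ≤ a → c ≤ f i) → a * c ≤ ∑ a f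
∑-lowerBound zero    c f _    = z≤n
∑-lowerBound (suc a) c f c≤f =
  +-mono-≤ (c≤f 1 ≤-refl (s≤s z≤n))
           (∑-lowerBound a c (f ∘ suc) (λ i _ i≤a → c≤f (suc i) (s≤s z≤n) (s≤s i≤a)))

∑-increment : ∀ B e f g → e ≤ B →
              (∀ i → 1 ≤ i → i ≤ e → g i ≡ suc (f i)) → (∀ i → e < i → g i ≡ f i) →
              ∑ B g ≡ e + ∑ B f
∑-increment zero    .zero   f g z≤n       _     _     = refl
∑-increment (suc B) zero    f g _         _     g≡f   =
  cong₂ _+_ (g≡f 1 z<s) (∑-increment B zero (f ∘ suc) (g ∘ suc) z≤n
                                     (λ { _ (s≤s _) () }) (λ i _ → g≡f (suc i) z<s))
∑-increment (suc B) (suc e) f g (s≤s e≤B) g≡1+f g≡f =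
  trans (cong₂ _+_ (g≡1+f 1 ≤-refl (s≤s z≤n))
                   (∑-increment B e (f ∘ suc) (g ∘ suc) e≤B
                                (λ i _ i≤e → g≡1+f (suc i) (s≤s z≤n) (s≤s i≤e))
                                (λ i e<i → g≡f (suc i) (s<s e<i))))
        (cong suc (x+[y+z]≡y+[x+z] (f 1) e _))

-- a ≤ K makes the index ranges [1, a] and [K + 1, K + a] disjoint, so the a gains c add up.
∑-pairing : ∀ {a K B c} (g h : ℕ → ℕ) → (∀ i → h i ≤ g i) → a ≤ K → K + a ≤ B →
            (∀ i → 1 ≤ i → i ≤ a → h i + h (K + i) + c ≤ g i + g (K + i)) →
            ∑ B h + a * c ≤ ∑ B g
∑-pairing {a} {K} {B} {c} g h h≤g a≤K K+a≤B pairGain = begin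
  ∑ B h + a * c                  ≤⟨ +-monoʳ-≤ (∑ B h) a*c≤∑δ ⟩
  ∑ B h + ∑ B δ                  ≡⟨ ∑-distrib-+ B h δ ⟨
  ∑ B (λ i → h i + δ i)          ≡⟨ ∑-cong B g≡h+δ ⟨
  ∑ B g                          ∎
  where
  open ≤-Reasoning
  δ : ℕ → ℕ
  δ i = g i ∸ h i
  g≡h+δ : ∀ i → g i ≡ h i + δ i
  g≡h+δ i = sym (m+[n∸m]≡n (h≤g i))
  pairδ : ∀ i → 1 ≤ i → i ≤ a → c ≤ δ i + δ (K + i)
  pairδ i 1≤i i≤a = +-cancelˡ-≤ (h i + h (K + i)) _ _ (begin
    h i + h (K + i) + c                    ≤⟨ pairGain i 1≤i i≤a ⟩
    g i + g (K + i)                        ≡⟨ cong₂ _+_ (g≡h+δ i) (g≡h+δ (K + i)) ⟩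
    h i + δ i + (h (K + i) + δ (K + i))    ≡⟨ +-interchange (h i) (δ i) _ _ ⟩
    h i + h (K + i) + (δ i + δ (K + i))    ∎)
  a*c≤∑δ : a * c ≤ ∑ B δ
  a*c≤∑δ = begin
    a * c                                     ≤⟨ ∑-lowerBound a c _ pairδ ⟩
    ∑ a (λ i → δ i + δ (K + i))               ≡⟨ ∑-distrib-+ a δ (λ i → δ (K + i)) ⟩
    ∑ a δ + ∑ a (λ i → δ (K + i))             ≤⟨ +-monoˡ-≤ _ (∑-monoˡ-≤ δ a≤K) ⟩
    ∑ K δ + ∑ a (λ i → δ (K + i))             ≡⟨ ∑-split K a δ ⟨
    ∑ (K + a) δ                               ≤⟨ ∑-monoˡ-≤ δ K+a≤B ⟩
    ∑ B δ                                     ∎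

[r+k*d]/d≡k : ∀ r k d .{{_ : NonZero d}} → r < d → (r + k * d) / d ≡ k
[r+k*d]/d≡k r k d r<d = begin
  (r + k * d) / d    ≡⟨ +-distrib-/-∣ʳ r (n∣m*n k) ⟩
  r / d + k * d / d  ≡⟨ cong₂ _+_ (m<n⇒m/n≡0 r<d) (m*n/n≡m k d) ⟩
  k                  ∎
  where open ≡-Reasoning

m<[1+m/n]*n : ∀ m n .{{_ : NonZero n}} → m < suc (m / n) * n
m<[1+m/n]*n m n = begin-strict
  m                    ≡⟨ m≡m%n+[m/n]*n m n ⟩
  m % n + (m / n) * n  <⟨ +-monoˡ-< ((m / n) * n) (m%n<n m n) ⟩
  suc (m / n) * n      ∎
  where open ≤-Reasoning

/-suc-∣ : ∀ N d .{{_ : NonZero d}} → d ∣ suc N → suc N / d ≡ suc (N / d)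
/-suc-∣ N d@(suc d-1) (divides zero    1+N≡0)   = ⊥-elim (1+n≢0 1+N≡0)
/-suc-∣ N d@(suc d-1) (divides (suc t) 1+N≡t*d) = begin
  suc N / d                   ≡⟨ /-congˡ 1+N≡t*d ⟩
  suc t * d / d               ≡⟨ m*n/n≡m (suc t) d ⟩
  suc t                       ≡⟨ cong suc ([r+k*d]/d≡k d-1 t d ≤-refl) ⟨
  suc ((d-1 + t * d) / d)     ≡⟨ cong (λ m → suc (m / d)) (suc-injective 1+N≡t*d) ⟨
  suc (N / d)                 ∎
  where open ≡-Reasoning

/-suc-∤ : ∀ N d .{{_ : NonZero d}} → ¬ d ∣ suc N → suc N / d ≡ N / d
/-suc-∤ N d d∤1+N with m≤n⇒m<n∨m≡n (m%n<n N d)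
... | inj₁ 1+r<d = begin
  suc N / d                          ≡⟨ cong (λ m → suc m / d) (m≡m%n+[m/n]*n N d) ⟩
  (suc (N % d) + (N / d) * d) / d   ≡⟨ [r+k*d]/d≡k (suc (N % d)) (N / d) d 1+r<d ⟩
  N / d                              ∎
  where open ≡-Reasoning
... | inj₂ 1+r≡d = ⊥-elim (d∤1+N (divides (suc (N / d)) (begin
  suc N                            ≡⟨ cong suc (m≡m%n+[m/n]*n N d) ⟩
  suc (N % d) + (N / d) * d       ≡⟨ cong (_+ (N / d) * d) 1+r≡d ⟩
  suc (N / d) * d                  ∎)))
  where open ≡-Reasoning

*-/-≤ : ∀ m n d .{{_ : NonZero d}} → m * (n / d) ≤ m * n / d
*-/-≤ m n d = begin
  m * (n / d)          ≡⟨ m*n/n≡m (m * (n / d)) d ⟨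
  m * (n / d) * d / d  ≤⟨ /-monoˡ-≤ d (≤-reflexive (*-assoc m (n / d) d)) ⟩ 
  m * (n / d * d) / d  ≤⟨ /-monoˡ-≤ d (*-monoʳ-≤ m (m/n*n≤m n d)) ⟩
  m * n / d            ∎
  where open ≤-Reasoning

/-mono-*-≤ : ∀ {l M} E d .{{_ : NonZero d}} .{{_ : NonZero (E * d)}} → E * l ≤ M → l / d ≤ M / (E * d)
/-mono-*-≤ {l} {M} E d El≤M = begin
  l / d            ≡⟨ m*n/m*o≡n/o E l d ⟨
  E * l / (E * d)  ≤⟨ /-monoˡ-≤ (E * d) El≤M ⟩
  M / (E * d)      ∎
  where open ≤-Reasoning

-- With d ∣ n + 1 this amounts to ⌈(l + 1) / d⌉ = ⌊l / d⌋ + 1.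
/-suc-*-∣ : ∀ l n d .{{_ : NonZero d}} → d ∣ suc n → suc l * (n / d) + l ≤ suc l * n / d + l / d
/-suc-*-∣ l n d (divides t 1+n≡t*d) = ≤-pred (≤-pred (begin-strict
  suc (L * (n / d) + l)   ≡⟨ +-suc (L * (n / d)) l ⟨
  L * (n / d) + L         ≡⟨ +-comm (L * (n / d)) L ⟩
  L + L * (n / d)         ≡⟨ *-suc L (n / d) ⟨
  L * suc (n / d)         ≤⟨ *-monoʳ-≤ L n/d<t ⟩
  L * t                   <⟨ *-cancelʳ-< d _ _ Ltd<[X+A+2]d ⟩
  suc (suc (X + A))       ∎))
  where
  open ≤-Reasoning
  L = suc l
  X = L * n / d
  A = l / d
  n/d<t : n / d < t
  n/d<t = *-cancelʳ-< d _ _ (≤-<-trans (m/n*n≤m n d) (≤-reflexive 1+n≡t*d))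
  Ltd<[X+A+2]d : L * t * d < suc (suc (X + A)) * d
  Ltd<[X+A+2]d = begin-strict
    L * t * d                  ≡⟨ *-assoc L t d ⟩
    L * (t * d)                ≡⟨ cong (L *_) 1+n≡t*d ⟨
    L * suc n                  ≡⟨ *-suc L n ⟩
    L + L * n                  <⟨ +-mono-≤-< (m<[1+m/n]*n l d) (m<[1+m/n]*n (L * n) d) ⟩
    suc A * d + suc X * d      ≡⟨ *-distribʳ-+ d (suc A) (suc X) ⟨
    (suc A + suc X) * d        ≡⟨ cong (λ m → suc m * d) (trans (+-suc A X) (cong suc (+-comm A X))) ⟩
    suc (suc (X + A)) * d      ∎

n<m^n : ∀ m → 1 < m → ∀ n → n < m ^ n
n<m^n m         1<m zero    = z<s
n<m^n m@(suc _) 1<m (suc n) = begin-strict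
  suc n       ≤⟨ n<m^n m 1<m n ⟩
  m ^ n       <⟨ m<m*n (m ^ n) m {{m^n≢0 m n}} 1<m ⟩
  m ^ n * m   ≡⟨ *-comm (m ^ n) m ⟩
  m * m ^ n   ∎
  where open ≤-Reasoning

^-cancelʳ-< : ∀ m .{{_ : NonZero m}} {i j} → m ^ i < m ^ j → i < j
^-cancelʳ-< m {i} {j} m^i<m^j with i <? j
... | yes i<j = i<j
... | no  i≮j = contradiction (^-monoʳ-≤ m (≮⇒≥ i≮j)) (<⇒≱ m^i<m^j)

^-monoʳ-∣ : ∀ q {i e} → i ≤ e → q ^ i ∣ q ^ e
^-monoʳ-∣ q {i} {e} i≤e = divides (q ^ (e ∸ i)) (begin
  q ^ e                 ≡⟨ cong (q ^_) (m+[n∸m]≡n i≤e) ⟨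
  q ^ (i + (e ∸ i))     ≡⟨ ^-distribˡ-+-* q i (e ∸ i) ⟩
  q ^ i * q ^ (e ∸ i)   ≡⟨ *-comm (q ^ i) _ ⟩
  q ^ (e ∸ i) * q ^ i   ∎)
  where open ≡-Reasoning

⌊log⌋-exists : ∀ {q n} → 1 < q → 1 ≤ n → ∃[ K ] q ^ K ≤ n × n < q ^ suc K
⌊log⌋-exists {q} {suc zero}    1<q _ = 0 , ≤-refl , subst (1 <_) (sym (*-identityʳ q)) 1<q
⌊log⌋-exists {q} {suc (suc n)} 1<q _ with ⌊log⌋-exists {q} {suc n} 1<q (s≤s z≤n)
... | K , q^K≤1+n , 1+n<q^[1+K] with suc (suc n) <? q ^ suc K
...   | yes 2+n<q^[1+K] = K , m≤n⇒m≤1+n q^K≤1+n , 2+n<q^[1+K]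
...   | no  2+n≮q^[1+K] = suc K , ≤-reflexive q^[1+K]≡2+n ,
                          subst (_< q ^ suc (suc K)) q^[1+K]≡2+n (^-monoʳ-< q 1<q (n<1+n (suc K)))
  where
  q^[1+K]≡2+n : q ^ suc K ≡ suc (suc n)
  q^[1+K]≡2+n = ≤-antisym (≮⇒≥ 2+n≮q^[1+K]) 1+n<q^[1+K]

prime⇒>1 : ∀ {p} → Prime p → 1 < p
prime⇒>1 {p} p-prime = nonTrivial⇒n>1 p {{prime⇒nonTrivial p-prime}}

prime∤1 : ∀ {q} → Prime q → ¬ q ∣ 1
prime∤1 q-prime q∣1 = ¬prime[1] (subst Prime (∣1⇒≡1 q∣1) q-prime)

∃-prime-∣ : ∀ {x} → 1 < x → ∃[ p ] Prime p × p ∣ x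
∃-prime-∣ {x@(suc _)} 1<x with factorise x
... | record { factors = [] ; isFactorisation = x≡1 } = ⊥-elim (<⇒≢ 1<x (sym x≡1))
... | record { factors = p ∷ ps ; isFactorisation = x≡p*ps ; factorsPrime = p-prime ∷ _ } =
  p , p-prime , subst (p ∣_) (sym x≡p*ps) (m∣m*n (product ps))

prime∣prime^⇒≡ : ∀ {p q} b → Prime p → Prime q → p ∣ q ^ b → p ≡ q
prime∣prime^⇒≡ zero    p-prime _       p∣1 = ⊥-elim (prime∤1 p-prime p∣1)
prime∣prime^⇒≡ (suc b) p-prime q-prime p∣q*q^b with euclidsLemma _ _ p-prime p∣q*q^b
... | inj₂ p∣q^b = prime∣prime^⇒≡ b p-prime q-prime p∣q^b
... | inj₁ p∣q with prime⇒irreducible q-prime p∣q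
...   | inj₁ p≡1 = ⊥-elim (¬prime[1] (subst Prime p≡1 p-prime))
...   | inj₂ p≡q = p≡q

infix 4 _^_∥_

record _^_∥_ (q e x : ℕ) : Set where
  constructor exactly
  field
    cofactor         : ℕ
    x≡q^e*cofactor   : x ≡ q ^ e * cofactor
    q∤cofactor       : ¬ q ∣ cofactor

∣∧∥⇒exponent>0 : ∀ {q e x} → q ∣ x → q ^ e ∥ x → 0 < e
∣∧∥⇒exponent>0 {e = zero}  q∣x (exactly w x≡w q∤w) =
  ⊥-elim (q∤w (subst (_ ∣_) (trans x≡w (*-identityˡ w)) q∣x))
∣∧∥⇒exponent>0 {e = suc _} _   _                    = z<s

∥⇒∣ : ∀ {q e x} → q ^ suc e ∥ x → q ∣ x
∥⇒∣ {q} {e} (exactly w x≡q^[1+e]*w _) =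
  subst (q ∣_) (sym (trans x≡q^[1+e]*w (*-assoc q (q ^ e) w))) (m∣m*n (q ^ e * w))

∥-unique : ∀ {q e f x} .{{_ : NonZero q}} → q ^ e ∥ x → q ^ f ∥ x → e ≡ f
∥-unique {e = zero}  {zero}  _     _     = refl
∥-unique {e = zero}  {suc f} q^0∥x q^f∥x = ⊥-elim (n≮0 (∣∧∥⇒exponent>0 (∥⇒∣ q^f∥x) q^0∥x))
∥-unique {e = suc e} {zero}  q^e∥x q^0∥x = ⊥-elim (n≮0 (∣∧∥⇒exponent>0 (∥⇒∣ q^e∥x) q^0∥x))
∥-unique {q} {suc e} {suc f} (exactly w x≡q^[1+e]*w q∤w) (exactly v x≡q^[1+f]*v q∤v) =
  cong suc (∥-unique (exactly w refl q∤w) (exactly v (*-cancelˡ-≡ _ _ q q*q^e*w≡q*q^f*v) q∤v))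
  where
  q*q^e*w≡q*q^f*v : q * (q ^ e * w) ≡ q * (q ^ f * v)
  q*q^e*w≡q*q^f*v = begin
    q * (q ^ e * w)  ≡⟨ *-assoc q (q ^ e) w ⟨
    q ^ suc e * w    ≡⟨ x≡q^[1+e]*w ⟨
    _                ≡⟨ x≡q^[1+f]*v ⟩
    q ^ suc f * v    ≡⟨ *-assoc q (q ^ f) v ⟩
    q * (q ^ f * v)  ∎
    where open ≡-Reasoning

∥-exists : ∀ {q} → 1 < q → ∀ x → .{{NonZero x}} → ∃[ e ] q ^ e ∥ x
∥-exists {q} 1<q = <-rec P go
  where
  P : ℕ → Set
  P x = .{{NonZero x}} → ∃[ e ] q ^ e ∥ x
  go : ∀ x → (∀ {y} → y < x → P y) → P x
  go x rec with q ∣? x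
  ... | no  q∤x = 0 , exactly x (sym (*-identityˡ x)) q∤x
  ... | yes (divides y x≡y*q) with rec y<x {{y≢0}}
    where
    y≢0 : NonZero y
    y≢0 = ≢-nonZero (λ y≡0 → ≢-nonZero⁻¹ x (trans x≡y*q (cong (_* q) y≡0)))
    y<x : y < x
    y<x = subst (y <_) (sym x≡y*q) (m<m*n y q {{y≢0}} 1<q)
  ...   | e , exactly w y≡q^e*w q∤w = suc e , exactly w x≡q^[1+e]*w q∤w
    where
    x≡q^[1+e]*w : x ≡ q ^ suc e * w
    x≡q^[1+e]*w = trans x≡y*q (trans (cong (_* q) y≡q^e*w) (trans (*-comm _ q) (sym (*-assoc q (q ^ e) w))))

∥-* : ∀ {q e f x y} → Prime q → q ^ e ∥ x → q ^ f ∥ y → q ^ (e + f) ∥ x * y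
∥-* {q} {e} {f} q-prime (exactly w x≡q^e*w q∤w) (exactly v y≡q^f*v q∤v) =
  exactly (w * v) xy≡q^[e+f]*wv q∤wv
  where
  q∤wv : ¬ q ∣ w * v
  q∤wv q∣wv with euclidsLemma w v q-prime q∣wv
  ... | inj₁ q∣w = q∤w q∣w
  ... | inj₂ q∣v = q∤v q∣v
  xy≡q^[e+f]*wv : _ ≡ q ^ (e + f) * (w * v)
  xy≡q^[e+f]*wv = trans (cong₂ _*_ x≡q^e*w y≡q^f*v)
    (trans (*-interchange (q ^ e) w (q ^ f) v) (cong (_* (w * v)) (sym (^-distribˡ-+-* q e f))))

∥-^ : ∀ {q e x} → Prime q → q ^ e ∥ x → ∀ k → q ^ (k * e) ∥ x ^ k
∥-^ q-prime _  zero    = exactly 1 refl (prime∤1 q-prime)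
∥-^ q-prime qe∥x (suc k) = ∥-* q-prime qe∥x (∥-^ q-prime qe∥x k)

∥⇒^∣ : ∀ {q e i x} → i ≤ e → q ^ e ∥ x → q ^ i ∣ x
∥⇒^∣ {q} {i = i} i≤e (exactly w x≡q^e*w _) =
  subst (q ^ i ∣_) (sym x≡q^e*w) (∣-trans (^-monoʳ-∣ q i≤e) (m∣m*n w))

∥⇒^∤ : ∀ {q e i x} .{{_ : NonZero q}} → e < i → q ^ e ∥ x → ¬ q ^ i ∣ x
∥⇒^∤ {q} {e} e<i (exactly w x≡q^e*w q∤w) q^i∣x =
  q∤w (*-cancelˡ-∣ (q ^ e) {{m^n≢0 q e}} q^e*q∣q^e*w)
  where
  q^e*q∣q^e*w : q ^ e * q ∣ q ^ e * w
  q^e*q∣q^e*w = subst₂ _∣_ (*-comm q (q ^ e)) x≡q^e*w (∣-trans (^-monoʳ-∣ q e<i) q^i∣x)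

prime^-coprime : ∀ {p r} a → Prime p → ¬ p ∣ r → Coprime (p ^ a) r
prime^-coprime {p} a p-prime p∤r {zero} (_ , 0∣r) = ⊥-elim (p∤r (subst (p ∣_) (sym (0∣⇒≡0 0∣r)) (p ∣0)))
prime^-coprime a p-prime p∤r {suc zero} _ = refl
prime^-coprime a p-prime p∤r {i@(suc (suc _))} (i∣p^a , i∣r)
  with ∃-prime-∣ {i} (s≤s (s≤s z≤n))
... | t , t-prime , t∣i with prime∣prime^⇒≡ a t-prime p-prime (∣-trans t∣i i∣p^a)
...   | refl = ⊥-elim (p∤r (∣-trans t∣i i∣r))

coprime-*-∣ : ∀ {m n o} → Coprime m n → m ∣ o → n ∣ o → m * n ∣ o
coprime-*-∣ {m} {n} m⊥n (divides k o≡k*m) n∣o =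
  subst (m * n ∣_) (trans (*-comm m k) (sym o≡k*m)) (*-monoʳ-∣ m n∣k)
  where
  n∣k : n ∣ k
  n∣k = coprime-divisor (⊥-sym m⊥n) (subst (n ∣_) (trans o≡k*m (*-comm k m)) n∣o)

ExactPrimePowersDivide : ℕ → ℕ → Set
ExactPrimePowersDivide A B = ∀ {q e} → Prime q → q ^ e ∥ A → q ^ e ∣ B

exactPrimePowersDivide⇒∣ : ∀ {B} A .{{_ : NonZero A}} → ExactPrimePowersDivide A B → A ∣ B
exactPrimePowersDivide⇒∣ {B} = <-rec P go
  where
  P : ℕ → Set
  P A = .{{NonZero A}} → ExactPrimePowersDivide A B → A ∣ B
  go : ∀ A → (∀ {r} → r < A → P r) → P A
  go zero            _   _   = ⊥-elim (≢-nonZero⁻¹ 0 refl)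
  go (suc zero)      _   _   = 1∣ B
  go A@(suc (suc _)) rec hyp with ∃-prime-∣ {A} (s≤s (s≤s z≤n))
  ... | p , p-prime , p∣A with ∥-exists (prime⇒>1 p-prime) A
  ...   | a , p^a∥A@(exactly r A≡p^a*r p∤r) =
    subst (_∣ B) (sym A≡p^a*r) (coprime-*-∣ (prime^-coprime a p-prime p∤r) (hyp p-prime p^a∥A) r∣B)
    where
    instance
      p≢0 : NonZero p
      p≢0 = prime⇒nonZero p-prime
      r≢0 : NonZero r
      r≢0 = ≢-nonZero λ r≡0 → ≢-nonZero⁻¹ A (trans A≡p^a*r (trans (cong (p ^ a *_) r≡0) (*-zeroʳ (p ^ a))))
    r<A : r < A
    r<A = begin-strict
      r          <⟨ m<m*n r (p ^ a) (^-monoʳ-< p (prime⇒>1 p-prime) (∣∧∥⇒exponent>0 p∣A p^a∥A)) ⟩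
      r * p ^ a  ≡⟨ *-comm r (p ^ a) ⟩
      p ^ a * r  ≡⟨ A≡p^a*r ⟨
      A          ∎
      where open ≤-Reasoning
    r∣B : r ∣ B
    r∣B = rec r<A hyp′
      where
      hyp′ : ExactPrimePowersDivide r B
      hyp′ {q} {e} q-prime q^e∥r with q ≟ p
      ... | yes refl = subst (λ e → q ^ e ∣ B) (∥-unique q^0∥r q^e∥r) (1∣ B)
        where
        q^0∥r : q ^ 0 ∥ r
        q^0∥r = exactly r (sym (*-identityˡ r)) p∤r
      ... | no  q≢p  = hyp q-prime (subst (q ^ e ∥_) (sym A≡p^a*r) (∥-* q-prime q^0∥p^a q^e∥r))
        where
        q^0∥p^a : q ^ 0 ∥ p ^ a
        q^0∥p^a = exactly (p ^ a) (sym (*-identityˡ (p ^ a))) (q≢p ∘ prime∣prime^⇒≡ a q-prime p-prime)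

module Legendre {q : ℕ} (q-prime : Prime q) where

  instance
    q≢0 : NonZero q
    q≢0 = prime⇒nonZero q-prime

  1<q : 1 < q
  1<q = prime⇒>1 q-prime

  q^≢0 : ∀ i → NonZero (q ^ i)
  q^≢0 i = m^n≢0 q i

  infixl 7 _/q^_
  _/q^_ : ℕ → ℕ → ℕ
  N /q^ i = (N / q ^ i) {{q^≢0 i}}

  legendre : ℕ → ℕ
  legendre N = ∑ N (N /q^_)

  legendre-∑ : ∀ {N B} → N ≤ B → ∑ B (N /q^_) ≡ legendre N
  legendre-∑ {N} {B} N≤B = ∑-vanishing N B (N /q^_) N≤B
    (λ i N<i → m<n⇒m/n≡0 {{q^≢0 i}} (<-trans (n<m^n q 1<q N) (^-monoʳ-< q 1<q N<i)))

  legendre-suc : ∀ {e N} → q ^ e ∥ suc N → legendre (suc N) ≡ e + legendre N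
  legendre-suc {e} {N} q^e∥1+N = begin
    ∑ (suc N) (suc N /q^_)  ≡⟨ ∑-increment (suc N) e (N /q^_) (suc N /q^_) e≤1+N below above ⟩
    e + ∑ (suc N) (N /q^_)  ≡⟨ cong (e +_) (legendre-∑ (n≤1+n N)) ⟩
    e + legendre N          ∎
    where
    open ≡-Reasoning
    e≤1+N : e ≤ suc N
    e≤1+N = <⇒≤ (<-≤-trans (n<m^n q 1<q e) (∣⇒≤ (∥⇒^∣ ≤-refl q^e∥1+N)))
    below : ∀ i → 1 ≤ i → i ≤ e → suc N /q^ i ≡ suc (N /q^ i)
    below i _ i≤e = /-suc-∣ N (q ^ i) {{q^≢0 i}} (∥⇒^∣ i≤e q^e∥1+N)
    above : ∀ i → e < i → suc N /q^ i ≡ N /q^ i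
    above i e<i = /-suc-∤ N (q ^ i) {{q^≢0 i}} (∥⇒^∤ e<i q^e∥1+N)

  legendre-formula : ∀ N → q ^ legendre N ∥ N !
  legendre-formula zero    = exactly 1 refl (prime∤1 q-prime)
  legendre-formula (suc N) with ∥-exists 1<q (suc N)
  ... | e , q^e∥1+N = subst (λ k → q ^ k ∥ suc N !) (sym (legendre-suc q^e∥1+N))
                            (∥-* q-prime q^e∥1+N (legendre-formula N))

  legendre-q* : ∀ X → legendre (q * X) ≡ X + legendre X
  legendre-q* X = begin
    legendre (q * X)                                  ≡⟨ legendre-∑ (n≤1+n (q * X)) ⟨
    q * X /q^ 1 + ∑ (q * X) (λ i → q * X /q^ suc i)   ≡⟨ cong₂ _+_ first (∑-cong (q * X) shifted) ⟩
    X + ∑ (q * X) (X /q^_)                            ≡⟨ cong (X +_) (legendre-∑ (m≤n*m X q)) ⟩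
    X + legendre X                                    ∎
    where
    open ≡-Reasoning
    first : q * X /q^ 1 ≡ X
    first = trans (m*n/m*o≡n/o q X 1 {{_}} {{q^≢0 1}}) (n/1≡n X)
    shifted : ∀ i → q * X /q^ suc i ≡ X /q^ i
    shifted i = m*n/m*o≡n/o q X (q ^ i) {{q^≢0 i}} {{q^≢0 (suc i)}}

  legendre-q^* : ∀ a X → legendre (q ^ a * X) ≡ legendre X + X * legendre (q ^ a)
  legendre-q^* zero    X = begin
    legendre (1 * X)             ≡⟨ cong legendre (*-identityˡ X) ⟩
    legendre X                   ≡⟨ +-identityʳ (legendre X) ⟨
    legendre X + 0               ≡⟨ cong (legendre X +_) (*-zeroʳ X) ⟨
    legendre X + X * 0           ≡⟨ cong (λ k → legendre X + X * (k + 0)) 1/q≡0 ⟨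
    legendre X + X * legendre 1  ∎
    where
    open ≡-Reasoning
    1/q≡0 : 1 /q^ 1 ≡ 0
    1/q≡0 = m<n⇒m/n≡0 {{q^≢0 1}} (subst (1 <_) (sym (*-identityʳ q)) 1<q)
  legendre-q^* (suc a) X = begin
    legendre (q * q ^ a * X)                         ≡⟨ cong legendre (*-assoc q (q ^ a) X) ⟩
    legendre (q * (q ^ a * X))                       ≡⟨ legendre-q* (q ^ a * X) ⟩
    q ^ a * X + legendre (q ^ a * X)                 ≡⟨ cong (q ^ a * X +_) (legendre-q^* a X) ⟩
    q ^ a * X + (legendre X + X * legendre (q ^ a))  ≡⟨ rearrange (q ^ a) X (legendre X) _ ⟩
    legendre X + X * (q ^ a + legendre (q ^ a))      ≡⟨ cong (λ k → legendre X + X * k) (legendre-q* _) ⟨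
    legendre X + X * legendre (q * q ^ a)            ∎
    where
    open ≡-Reasoning
    rearrange : ∀ p x y z → p * x + (y + x * z) ≡ y + x * (p + z)
    rearrange = solve-∀

  -- When q ^ a ∥ n + 1, a + legendre n = legendre (n + 1), so this reads L ν_q((n + 1)!) ≤ ν_q((L n)!) + a.
  ValuationBound : ℕ → ℕ → ℕ → Set
  ValuationBound n a L = L * (a + legendre n) ≤ legendre (L * n) + a

  valuationBound-pairing : ∀ {n a K} l → q ^ a ∣ suc n → a ≤ K → n < q ^ suc K →
                           l * q ^ K ≤ suc l * n → ValuationBound n a (suc l)
  valuationBound-pairing {n} {a} {K} l q^a∣1+n a≤K n<q^[1+K] lq^K≤Ln = begin
    L * (a + legendre n)      ≡⟨ rearrange l a (legendre n) ⟩
    L * legendre n + a * l + a ≤⟨ +-monoˡ-≤ a (begin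
      L * legendre n + a * l   ≡⟨ cong (λ k → L * k + a * l) (legendre-∑ n≤B) ⟨
      L * ∑ B (n /q^_) + a * l ≡⟨ cong (_+ a * l) (∑-distribˡ-* B L (n /q^_)) ⟨
      ∑ B h + a * l            ≤⟨ ∑-pairing g h h≤g a≤K (m≤m+n (K + a) (L * n)) pairGain ⟩
      ∑ B g                    ≡⟨ legendre-∑ (m≤n+m (L * n) (K + a)) ⟩
      legendre (L * n)         ∎) ⟩
    legendre (L * n) + a       ∎
    where
    open ≤-Reasoning
    L = suc l
    B = K + a + L * n
    n≤B : n ≤ B
    n≤B = ≤-trans (m≤n*m n L) (m≤n+m (L * n) (K + a))
    g h : ℕ → ℕ
    g i = L * n /q^ i
    h i = L * (n /q^ i)
    h≤g : ∀ i → h i ≤ g i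
    h≤g i = *-/-≤ L n (q ^ i) {{q^≢0 i}}
    rearrange : ∀ L a x → suc L * (a + x) ≡ suc L * x + a * L + a
    rearrange = solve-∀
    pairGain : ∀ i → 1 ≤ i → i ≤ a → h i + h (K + i) + l ≤ g i + g (K + i)
    pairGain i 1≤i i≤a = begin
      h i + h (K + i) + l   ≡⟨ cong (λ k → h i + L * k + l) (m<n⇒m/n≡0 {{q^≢0 (K + i)}} n<q^[K+i]) ⟩
      h i + L * 0 + l       ≡⟨ cong (λ k → h i + k + l) (*-zeroʳ L) ⟩
      h i + 0 + l           ≡⟨ cong (_+ l) (+-identityʳ (h i)) ⟩
      h i + l               ≤⟨ /-suc-*-∣ l n (q ^ i) {{q^≢0 i}} q^i∣1+n ⟩
      g i + l /q^ i         ≤⟨ +-monoʳ-≤ (g i) l/q^i≤g[K+i] ⟩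
      g i + g (K + i)       ∎
      where
      n<q^[K+i] : n < q ^ (K + i)
      n<q^[K+i] = <-≤-trans n<q^[1+K] (^-monoʳ-≤ q (subst (_≤ K + i) (+-comm K 1) (+-monoʳ-≤ K 1≤i)))
      q^i∣1+n : q ^ i ∣ suc n
      q^i∣1+n = ∣-trans (^-monoʳ-∣ q i≤a) q^a∣1+n
      l/q^i≤g[K+i] : l /q^ i ≤ g (K + i)
      l/q^i≤g[K+i] = begin
        l /q^ i                    ≤⟨ /-mono-*-≤ (q ^ K) (q ^ i) {{q^≢0 i}} q^K*l≤Ln ⟩
        L * n / (q ^ K * q ^ i)    ≡⟨ /-congʳ {{q^≢0 (K + i)}} (^-distribˡ-+-* q K i) ⟨
        g (K + i)                  ∎
        where
        instance
          q^K*q^i≢0 : NonZero (q ^ K * q ^ i)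
          q^K*q^i≢0 = m*n≢0 (q ^ K) (q ^ i) {{q^≢0 K}} {{q^≢0 i}}
        q^K*l≤Ln : q ^ K * l ≤ L * n
        q^K*l≤Ln = subst (_≤ L * n) (*-comm l (q ^ K)) lq^K≤Ln

  valuationBound-small : ∀ {n a} l → q ^ a ∣ suc n → q ^ a ≤ n → ValuationBound n a (suc l)
  valuationBound-small {n} {a} l q^a∣1+n q^a≤n with ⌊log⌋-exists 1<q (≤-trans (m^n>0 q a) q^a≤n)
  ... | K , q^K≤n , n<q^[1+K] = valuationBound-pairing l q^a∣1+n a≤K n<q^[1+K] lq^K≤Ln
    where
    a≤K : a ≤ K
    a≤K = ≤-pred (^-cancelʳ-< q (≤-<-trans q^a≤n n<q^[1+K]))
    lq^K≤Ln : l * q ^ K ≤ suc l * n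
    lq^K≤Ln = ≤-trans (*-monoʳ-≤ l q^K≤n) (*-monoˡ-≤ n (n≤1+n l))

  valuationBound-digit : ∀ {n a} l → suc n ≡ q ^ a → l ≤ n → ValuationBound n a (suc l)
  valuationBound-digit {n} {a} l 1+n≡q^a l≤n =
    valuationBound-pairing l (∣-reflexive (sym 1+n≡q^a)) ≤-refl n<q^[1+a] lq^a≤Ln
    where
    open ≤-Reasoning
    n<q^[1+a] : n < q ^ suc a
    n<q^[1+a] = begin-strict
      n           <⟨ n<1+n n ⟩
      suc n       ≡⟨ 1+n≡q^a ⟩
      q ^ a       ≤⟨ ^-monoʳ-≤ q (n≤1+n a) ⟩
      q ^ suc a   ∎
    lq^a≤Ln : l * q ^ a ≤ suc l * n
    lq^a≤Ln = begin
      l * q ^ a   ≡⟨ cong (l *_) 1+n≡q^a ⟨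
      l * suc n   ≡⟨ *-suc l n ⟩
      l + l * n   ≤⟨ +-monoˡ-≤ (l * n) l≤n ⟩
      n + l * n   ∎

  valuationBound-[1+n]* : ∀ {n a L} → suc n ≡ q ^ a → ValuationBound n a L → ValuationBound n a (suc n * L)
  valuationBound-[1+n]* {n} {a} {L} 1+n≡q^a bound = begin
    suc n * L * s                        ≡⟨ split n L s ⟩
    L * s + L * n * s                    ≤⟨ +-monoˡ-≤ (L * n * s) bound ⟩
    legendre (L * n) + a + L * n * s     ≡⟨ x+y+z≡x+z+y (legendre (L * n)) a (L * n * s) ⟩
    legendre (L * n) + L * n * s + a     ≡⟨ cong (_+ a) legendre-[1+n]*Ln ⟨
    legendre (suc n * L * n) + a         ∎
    where
    open ≤-Reasoning
    s = a + legendre n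
    split : ∀ n L s → suc n * L * s ≡ L * s + L * n * s
    split = solve-∀
    legendre-q^a : legendre (q ^ a) ≡ s
    legendre-q^a = trans (cong legendre (sym 1+n≡q^a))
                         (legendre-suc (exactly 1 (trans 1+n≡q^a (sym (*-identityʳ (q ^ a)))) (prime∤1 q-prime)))
    legendre-[1+n]*Ln : legendre (suc n * L * n) ≡ legendre (L * n) + L * n * s
    legendre-[1+n]*Ln = begin-equality
      legendre (suc n * L * n)                     ≡⟨ cong legendre (*-assoc (suc n) L n) ⟩
      legendre (suc n * (L * n))                   ≡⟨ cong (λ m → legendre (m * (L * n))) 1+n≡q^a ⟩
      legendre (q ^ a * (L * n))                   ≡⟨ legendre-q^* a (L * n) ⟩
      legendre (L * n) + L * n * legendre (q ^ a)  ≡⟨ cong (λ k → legendre (L * n) + L * n * k) legendre-q^a ⟩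
      legendre (L * n) + L * n * s                 ∎

  valuationBound-digit*power : ∀ {n a d} k → suc n ≡ q ^ a → 1 ≤ d → d ≤ suc n →
                               ValuationBound n a (d * suc n ^ k)
  valuationBound-digit*power {n} {a} {suc l} zero 1+n≡q^a _ (s≤s l≤n) =
    subst (ValuationBound n a) (sym (*-identityʳ (suc l))) (valuationBound-digit l 1+n≡q^a l≤n)
  valuationBound-digit*power {n} {a} {d} (suc k) 1+n≡q^a 1≤d d≤1+n =
    subst (ValuationBound n a) (x*[y*z]≡y*[x*z] (suc n) d (suc n ^ k))
          (valuationBound-[1+n]* {L = d * suc n ^ k} 1+n≡q^a (valuationBound-digit*power k 1+n≡q^a 1≤d d≤1+n))

SingleNonZeroDigit : ℕ → ℕ → Set
SingleNonZeroDigit b m = ∃[ d ] ∃[ k ] m ≡ d * b ^ k × 1 ≤ d × d < b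

nonZeroDigits≡0⇒fromDigits≡0 : ∀ {b} (ds : Expansion b) → nonZeroDigits ds ≡ 0 → fromDigits ds ≡ 0
nonZeroDigits≡0⇒fromDigits≡0 []       _ = refl
nonZeroDigits≡0⇒fromDigits≡0 {b} (x ∷ ds) none with toℕ x
... | zero  = cong (_* b) (nonZeroDigits≡0⇒fromDigits≡0 ds none)
... | suc _ = ⊥-elim (1+n≢0 none)

nonZeroDigits≤1 : ∀ {b} (ds : Expansion b) → nonZeroDigits ds ≤ 1 →
                  fromDigits ds ≡ 0 ⊎ SingleNonZeroDigit b (fromDigits ds)
nonZeroDigits≤1 []       _ = inj₁ refl
nonZeroDigits≤1 {b} (x ∷ ds) atMostOne with toℕ x in x≡ | nonZeroDigits≤1 ds
... | zero  | rest with rest atMostOne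
...   | inj₁ ds≡0 = inj₁ (cong (_* b) ds≡0)
...   | inj₂ (d , k , ds≡d*b^k , 1≤d , d<b) = inj₂ (d , suc k , ds*b≡d*b^[1+k] , 1≤d , d<b)
  where
  ds*b≡d*b^[1+k] : fromDigits ds * b ≡ d * (b * b ^ k)
  ds*b≡d*b^[1+k] = trans (cong (_* b) ds≡d*b^k) (trans (*-assoc d (b ^ k) b) (cong (d *_) (*-comm (b ^ k) b)))
nonZeroDigits≤1 {b} (x ∷ ds) (s≤s none) | suc m | _ =
  inj₂ (suc m , 0 , x+ds*b≡x , s≤s z≤n , subst (_< b) x≡ (toℕ<n x))
  where
  x+ds*b≡x : suc m + fromDigits ds * b ≡ suc m * 1
  x+ds*b≡x = begin
    suc m + fromDigits ds * b  ≡⟨ cong (λ v → suc m + v * b) ds≡0 ⟩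
    suc m + 0                  ≡⟨ +-identityʳ (suc m) ⟩
    suc m                      ≡⟨ *-identityʳ (suc m) ⟨
    suc m * 1                  ∎
    where
    open ≡-Reasoning
    ds≡0 : fromDigits ds ≡ 0
    ds≡0 = nonZeroDigits≡0⇒fromDigits≡0 ds (n≤0⇒n≡0 none)

¬single⇒atLeastTwoNonZeroDigits : ∀ {b m} → ¬ SingleNonZeroDigit b (suc m) →
                                  AtLeastTwoNonZeroDigits b (suc m)
¬single⇒atLeastTwoNonZeroDigits ¬single ds ds≡1+m with 2 ≤? nonZeroDigits ds
... | yes two = two
... | no  ¬two with nonZeroDigits≤1 ds (≤-pred (≰⇒> ¬two))
...   | inj₁ ds≡0    = ⊥-elim (1+n≢0 (trans (sym ds≡1+m) ds≡0))
...   | inj₂ single  = ⊥-elim (¬single (subst (SingleNonZeroDigit _) ds≡1+m single))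

isPrimePower? : ∀ m → 1 < m → Dec (IsPrimePower m)
isPrimePower? m@(suc _) 1<m with ∃-prime-∣ 1<m
... | p , p-prime , p∣m with ∥-exists (prime⇒>1 p-prime) m
...   | a , p^a∥m@(exactly r m≡p^a*r p∤r) with r ≟ 1
...     | yes refl = yes (p , a , p-prime , ∣∧∥⇒exponent>0 p∣m p^a∥m , trans m≡p^a*r (*-identityʳ _))
...     | no  r≢1  = no ¬primePower
  where
  ¬primePower : ¬ IsPrimePower m
  ¬primePower (q , b , q-prime , _ , m≡q^b)
    with prime∣prime^⇒≡ b p-prime q-prime (subst (p ∣_) m≡q^b p∣m)
  ... | refl = r≢1 (*-cancelˡ-≡ r 1 (p ^ a) {{m^n≢0 p a {{prime⇒nonZero p-prime}}}} p^a*r≡p^a*1)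
    where
    m≡p^b*1 : m ≡ p ^ b * 1
    m≡p^b*1 = trans m≡q^b (sym (*-identityʳ (p ^ b)))
    a≡b : a ≡ b
    a≡b = ∥-unique {{prime⇒nonZero p-prime}} p^a∥m (exactly 1 m≡p^b*1 (prime∤1 p-prime))
    p^a*r≡p^a*1 : p ^ a * r ≡ p ^ a * 1
    p^a*r≡p^a*1 = trans (sym m≡p^a*r) (trans m≡p^b*1 (cong (λ e → p ^ e * 1) (sym a≡b)))

-- C_l(n) = ((l + 1) n)! / ((n + 1)^l (n!)^(l + 1)) is an integer.
Integral : ℕ → ℕ → Set
Integral l n = suc n ^ l * (n !) ^ suc l ∣ (suc l * n) !

integral-from-valuations : ∀ l n →
  (∀ {q a} (q-prime : Prime q) → q ^ a ∥ suc n → Legendre.ValuationBound q-prime n a (suc l)) →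
  Integral l n
integral-from-valuations l n bound = exactPrimePowersDivide⇒∣ (suc n ^ l * (n !) ^ suc l) {{A≢0}} q^e∣[Ln]!
  where
  A≢0 : NonZero (suc n ^ l * (n !) ^ suc l)
  A≢0 = m*n≢0 _ _ {{m^n≢0 (suc n) l}} {{m^n≢0 (n !) (suc l) {{n !≢0}}}}
  q^e∣[Ln]! : ExactPrimePowersDivide (suc n ^ l * (n !) ^ suc l) ((suc l * n) !)
  q^e∣[Ln]! {q} {e} q-prime q^e∥A with ∥-exists (prime⇒>1 q-prime) (suc n)
  ... | a , q^a∥1+n = ∥⇒^∣ e≤legendre[Ln] (legendre-formula (suc l * n))
    where
    open Legendre q-prime
    q^E∥A : q ^ (l * a + suc l * legendre n) ∥ suc n ^ l * (n !) ^ suc l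
    q^E∥A = ∥-* q-prime (∥-^ q-prime q^a∥1+n l) (∥-^ q-prime (legendre-formula n) (suc l))
    split : ∀ l a x → suc l * (a + x) ≡ a + (l * a + suc l * x)
    split = solve-∀
    E≤legendre[Ln] : l * a + suc l * legendre n ≤ legendre (suc l * n)
    E≤legendre[Ln] = +-cancelˡ-≤ a _ _
      (subst₂ _≤_ (split l a (legendre n)) (+-comm _ a) (bound q-prime q^a∥1+n))
    e≤legendre[Ln] : e ≤ legendre (suc l * n)
    e≤legendre[Ln] = subst (_≤ legendre (suc l * n)) (∥-unique q^E∥A q^e∥A) E≤legendre[Ln]

integral : ∀ {l n} → 1 ≤ n → (IsPrimePower (suc n) → SingleNonZeroDigit (suc n) (suc l)) → Integral l n
integral {l} {n} 1≤n primePower⇒single = integral-from-valuations l n bound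
  where
  bound : ∀ {q a} (q-prime : Prime q) → q ^ a ∥ suc n → Legendre.ValuationBound q-prime n a (suc l)
  bound {q} {a} q-prime q^a∥1+n = byCases (q ^ a ≤? n)
    where
    open Legendre q-prime
    q^a∣1+n : q ^ a ∣ suc n
    q^a∣1+n = ∥⇒^∣ ≤-refl q^a∥1+n
    digitCase : suc n ≡ q ^ a → 1 ≤ a → ValuationBound n a (suc l)
    digitCase 1+n≡q^a 1≤a with primePower⇒single (q , a , q-prime , 1≤a , 1+n≡q^a)
    ... | d , k , 1+l≡d*[1+n]^k , 1≤d , d<1+n =
      subst (ValuationBound n a) (sym 1+l≡d*[1+n]^k) (valuationBound-digit*power k 1+n≡q^a 1≤d (<⇒≤ d<1+n))
    byCases : Dec (q ^ a ≤ n) → ValuationBound n a (suc l)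
    byCases (yes q^a≤n) = valuationBound-small l q^a∣1+n q^a≤n
    byCases (no  q^a≰n) = digitCase (≤-antisym (≰⇒> q^a≰n) (∣⇒≤ q^a∣1+n))
                                    (n≢0⇒n>0 (λ a≡0 → q^a≰n (subst (λ e → q ^ e ≤ n) (sym a≡0) 1≤n)))

nonIntegral⇒primePower : ∀ {l n} → 1 ≤ n → ¬ Integral l n → IsPrimePower (suc n)
nonIntegral⇒primePower {l} 1≤n ¬integral with isPrimePower? _ (s≤s 1≤n)
... | yes primePower  = primePower
... | no  ¬primePower =
  contradiction (integral {l} 1≤n (λ primePower → contradiction primePower ¬primePower)) ¬integral

nonIntegral⇒atLeastTwoNonZeroDigits : ∀ {l n} → 1 ≤ n → ¬ Integral l n →
                                      AtLeastTwoNonZeroDigits (suc n) (suc l)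
nonIntegral⇒atLeastTwoNonZeroDigits 1≤n ¬integral =
  ¬single⇒atLeastTwoNonZeroDigits (λ single → ¬integral (integral 1≤n (λ _ → single)))

lemma9 : (l n : ℕ) → 1 ≤ l → 1 ≤ n →
    ¬ (((n + 1) ^ l * (n !) ^ (l + 1)) ∣ (((l + 1) * n) !)) →
    IsPrimePower (n + 1) × AtLeastTwoNonZeroDigits (n + 1) (l + 1)
lemma9 l n _ 1≤n ¬integral rewrite +-comm n 1 | +-comm l 1 =
  nonIntegral⇒primePower {l} 1≤n ¬integral , nonIntegral⇒atLeastTwoNonZeroDigits 1≤n ¬integral
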